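{- Let $X$ be a finite set with $|X|\ge2$, $\mathcal{P}$ a partition of $X$, $\mathcal{H}$ a hierarchy on $X$ with corresponding rooted phylogenetic tree $T$, and $$H=\{\{\mathrm{parent}(\mathrm{lca}_T(A)),\mathrm{lca}_T(A)\} : A\in\mathcal{P},\ \mathrm{lca}_T(A)\neq\rho_T\}.$$ Then $\mathcal{P}$ and $\mathcal{H}$ are compatible if and only if $\mathcal{P}=\mathcal{F}(T,H)$.
   Context: A rooted phylogenetic tree $T$ on $X$ is a rooted tree with root $\rho_T$ and leaf set $X$ in which every non-leaf vertex has at least two children; $\mathrm{parent}(v)$ is the parent of $v\ne\rho_T$ and $\mathrm{lca}_T(A)$ is the last common ancestor of nonempty $A\subseteq X$. A hierarchy on $X$ is a set system $\mathcal{H}\subseteq2^X$ with $\emptyset\notin\mathcal{H}$, $X\in\mathcal{H}$, all singletons in $\mathcal{H}$, and no two members overlapping; it corresponds to the unique rooted phylogenetic tree $T$ with $\mathcal{H}=\{L(T(v)):v\in V(T)\}$. For $H\subseteq E(T)$, $\mathcal{F}(T,H)$ is the partition of $X$ into leaf sets of the connected components of $T-H$; $\mathcal{P}$ and $\mathcal{H}$ are compatible if $\mathcal{P}=\mathcal{F}(T,H')$ for some $H'\subseteq E(T)$. -}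

module Defs where

open import Data.Nat using (ℕ)
open import Data.Fin using (Fin)
open import Data.Fin.Subset using (Subset; _∈_; _⊆_; _⊂_; _∩_; ⊤; ⁅_⁆; Empty; Nonempty)
open import Data.List using (List)
open import Data.List.Membership.Propositional renaming (_∈_ to _∈ᴸ_)
open import Data.Product using (Σ; ∃; _×_; _,_)
open import Data.Sum using (_⊎_)
open import Relation.Binary.PropositionalEquality using (_≡_; _≢_)
open import Relation.Binary.Construct.Closure.ReflexiveTransitive using (Star)
open import Relation.Nullary using (¬_)
open import Function.Bundles using (_⇔_)

-- The ground set X is Fin n; subsets of X are Data.Fin.Subset.
-- A set system is a finite list of subsets (duplicates irrelevant).
SetSystem : ℕ → Set
SetSystem n = List (Subset n)

record IsHierarchy {n : ℕ} (𝓗 : SetSystem n) : Set where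
  field
    nonempty   : ∀ {C} → C ∈ᴸ 𝓗 → Nonempty C
    hasX       : ⊤ ∈ᴸ 𝓗
    singletons : ∀ x → ⁅ x ⁆ ∈ᴸ 𝓗
    noOverlap  : ∀ {A B} → A ∈ᴸ 𝓗 → B ∈ᴸ 𝓗 → A ⊆ B ⊎ B ⊆ A ⊎ Empty (A ∩ B)

record IsPartition {n : ℕ} (𝓟 : SetSystem n) : Set where
  field
    nonempty : ∀ {A} → A ∈ᴸ 𝓟 → Nonempty A
    disjoint : ∀ {A B} → A ∈ᴸ 𝓟 → B ∈ᴸ 𝓟 → A ≡ B ⊎ Empty (A ∩ B)
    covers   : ∀ x → ∃ λ A → A ∈ᴸ 𝓟 × x ∈ A

SameBlock : {n : ℕ} → SetSystem n → Fin n → Fin n → Set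
SameBlock 𝓟 x y = ∃ λ A → A ∈ᴸ 𝓟 × x ∈ A × y ∈ A

-- The rooted phylogenetic tree T of a hierarchy 𝓗: its vertices are the
-- clusters of 𝓗 (vertex v ↔ L(T(v))), the root ρ_T is X = ⊤, the leaf x is ⁅ x ⁆.
Parent : {n : ℕ} → SetSystem n → Subset n → Subset n → Set
Parent 𝓗 C D = D ∈ᴸ 𝓗 × C ⊂ D × (∀ {E} → E ∈ᴸ 𝓗 → C ⊂ E → D ⊆ E)

Lca : {n : ℕ} → SetSystem n → Subset n → Subset n → Set
Lca 𝓗 A C = C ∈ᴸ 𝓗 × A ⊆ C × (∀ {E} → E ∈ᴸ 𝓗 → A ⊆ E → C ⊆ E)

-- An (undirected) edge {parent(C), C} of T, written as the pair (D , C), D = parent(C).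
Edge : Set → Set
Edge S = S × S

IsEdge : {n : ℕ} → SetSystem n → Edge (Subset n) → Set
IsEdge 𝓗 (D , C) = C ∈ᴸ 𝓗 × Parent 𝓗 C D

EdgeSet : ℕ → Set₁
EdgeSet n = Edge (Subset n) → Set

_⊆E_ : {n : ℕ} → EdgeSet n → SetSystem n → Set
_⊆E_ {n} H 𝓗 = ∀ (e : Edge (Subset n)) → H e → IsEdge 𝓗 e

Adj : {n : ℕ} → SetSystem n → EdgeSet n → Subset n → Subset n → Set
Adj 𝓗 H u v = (IsEdge 𝓗 (u , v) × ¬ H (u , v)) ⊎ (IsEdge 𝓗 (v , u) × ¬ H (v , u))

Connected : {n : ℕ} → SetSystem n → EdgeSet n → Subset n → Subset n → Set
Connected 𝓗 H = Star (Adj 𝓗 H)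

-- 𝓟 = 𝓕(T, H): the blocks of 𝓟 are exactly the (nonempty) leaf sets of the
-- components of T − H; equivalently (both being partitions of X) leaves x, y
-- are in the same block of 𝓟 iff they are in the same component of T − H.
PartitionEqF : {n : ℕ} → SetSystem n → SetSystem n → EdgeSet n → Set
PartitionEqF 𝓟 𝓗 H = ∀ x y → SameBlock 𝓟 x y ⇔ Connected 𝓗 H ⁅ x ⁆ ⁅ y ⁆

Compatible : {n : ℕ} → SetSystem n → SetSystem n → Set₁
Compatible {n} 𝓟 𝓗 = Σ (EdgeSet n) λ H' → H' ⊆E 𝓗 × PartitionEqF 𝓟 𝓗 H'

LcaEdges : {n : ℕ} → SetSystem n → SetSystem n → EdgeSet n
LcaEdges 𝓟 𝓗 (D , C) = ∃ λ A → A ∈ᴸ 𝓟 × Lca 𝓗 A C × C ≢ ⊤ × Parent 𝓗 C D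

-- Two leaves lie in the same component of T − E iff no edge (parent(V), V) of E
-- separates them, i.e. has exactly one of them below V: a path leaving the
-- subtree at V must use that edge, and if no edge of E separates x and y, both
-- climb to lca{x, y} avoiding E. If 𝓟 = 𝓕(T, H'), every block lies below each
-- edge of H' it meets. Hence the lca-edge of a block B cannot split a block A,
-- for H' would then separate no leaf of A from B; conversely a leaf enters the
-- subtree below an edge of H' containing a block A only through the lca-edge of
-- A, or trivially when lca(A) is the root. So H' and the lca-edges separate the
-- same pairs of leaves.
module Submission where

open import Defs
open import Data.Nat using (ℕ; _≥_)
open import Data.Fin using (Fin)
open import Data.Fin.Subset using (Subset; _∈_; _⊆_; _⊂_; _⊃_; ⊤; ⁅_⁆)
open import Data.Fin.Subset.Properties using (_∈?_; _⊆?_; _⊂?_; ⊆-antisym; ∈⊤; ⊆⊤; x∈⁅x⁆; x∈⁅y⁆⇒x≡y; x∈p∩q⁺)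
open import Data.Fin.Subset.Induction using (Acc; acc; ⊃-wellFounded)
open import Data.List using (List; []; _∷_)
open import Data.List.Membership.Propositional renaming (_∈_ to _∈ᴸ_)
open import Data.List.Relation.Unary.Any using (here; there)
open import Data.Product using (∃; _×_; _,_; proj₁; proj₂)
open import Data.Sum using (_⊎_; inj₁; inj₂; [_,_]′) renaming (swap to ⊎-swap)
open import Data.Empty using (⊥-elim)
open import Function using (id; _∘_)
open import Function.Bundles using (_⇔_; mk⇔; Equivalence)
open import Function.Properties.Equivalence using () renaming (sym to ⇔-sym; trans to ⇔-trans)
open import Relation.Binary.PropositionalEquality using (_≡_; refl; sym; trans; subst; cong₂)
open import Relation.Binary.Construct.Closure.ReflexiveTransitive using (ε; _◅_; _◅◅_; reverse)
open import Relation.Nullary using (¬_; yes; no)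
open import Relation.Nullary.Decidable using (_×-dec_)
open import Relation.Unary using (Decidable)

Unseparated : {n : ℕ} → EdgeSet n → Fin n → Fin n → Set
Unseparated E x y = ∀ {D V} → E (D , V) → x ∈ V ⇔ y ∈ V

⊆∧⊄⇒⊇ : ∀ {n} {U V : Subset n} → U ⊆ V → ¬ U ⊂ V → V ⊆ U
⊆∧⊄⇒⊇ {U = U} U⊆V U⊄V {x} x∈V with x ∈? U
... | yes x∈U = x∈U
... | no x∉U = ⊥-elim (U⊄V (U⊆V , x , x∈V , x∉U))

x∈p⇒⁅x⁆⊆p : ∀ {n} {x : Fin n} {V} → x ∈ V → ⁅ x ⁆ ⊆ V
x∈p⇒⁅x⁆⊆p {V = V} x∈V y∈⁅x⁆ = subst (_∈ V) (sym (x∈⁅y⁆⇒x≡y _ y∈⁅x⁆)) x∈V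

module Tree {n : ℕ} {𝓗 : SetSystem n} (hier : IsHierarchy 𝓗) where
  open IsHierarchy hier

  nested : ∀ {A B a} → A ∈ᴸ 𝓗 → B ∈ᴸ 𝓗 → a ∈ A → a ∈ B → A ⊆ B ⊎ B ⊆ A
  nested A∈𝓗 B∈𝓗 a∈A a∈B with noOverlap A∈𝓗 B∈𝓗
  ... | inj₁ A⊆B = inj₁ A⊆B
  ... | inj₂ (inj₁ B⊆A) = inj₂ B⊆A
  ... | inj₂ (inj₂ A∩B≡∅) = ⊥-elim (A∩B≡∅ (_ , x∈p∩q⁺ (a∈A , a∈B)))

  Least : List (Subset n) → (Subset n → Set) → Subset n → Set
  Least L Q M = M ∈ᴸ L × Q M × (∀ {E} → E ∈ᴸ L → Q E → M ⊆ E)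

  -- Clusters satisfying Q share the point a, so they form a chain.
  module _ {Q : Subset n → Set} (Q? : Decidable Q) {a : Fin n} (Q⇒a∈ : ∀ {E} → Q E → a ∈ E) where

    least-in : (L : List (Subset n)) → (∀ {E} → E ∈ᴸ L → E ∈ᴸ 𝓗) →
               (∀ {E} → E ∈ᴸ L → ¬ Q E) ⊎ ∃ (Least L Q)
    least-in [] L⊆𝓗 = inj₁ λ ()
    least-in (E ∷ L) L⊆𝓗 with least-in L (L⊆𝓗 ∘ there) | Q? E
    ... | inj₁ none | no ¬QE = inj₁ λ { (here refl) → ¬QE ; (there E'∈L) → none E'∈L }
    ... | inj₁ none | yes QE = inj₂ (E , here refl , QE , λ { (here refl) _ → id ; (there E'∈L) QE' → ⊥-elim (none E'∈L QE') })
    ... | inj₂ (M , M∈L , QM , M-least) | no ¬QE =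
          inj₂ (M , there M∈L , QM , λ { (here refl) QE → ⊥-elim (¬QE QE) ; (there E'∈L) → M-least E'∈L })
    ... | inj₂ (M , M∈L , QM , M-least) | yes QE with nested (L⊆𝓗 (here refl)) (L⊆𝓗 (there M∈L)) (Q⇒a∈ QE) (Q⇒a∈ QM)
    ...   | inj₁ E⊆M = inj₂ (E , here refl , QE , λ { (here refl) _ → id ; (there E'∈L) QE' → M-least E'∈L QE' ∘ E⊆M })
    ...   | inj₂ M⊆E = inj₂ (M , there M∈L , QM , λ { (here refl) _ → M⊆E ; (there E'∈L) → M-least E'∈L })

    least : ∀ {E} → E ∈ᴸ 𝓗 → Q E → ∃ (Least 𝓗 Q)
    least E∈𝓗 QE = [ (λ none → ⊥-elim (none E∈𝓗 QE)) , id ]′ (least-in 𝓗 id)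

  lca-exists : ∀ {A a} → a ∈ A → ∃ (Lca 𝓗 A)
  lca-exists {A} a∈A = least (A ⊆?_) (λ A⊆E → A⊆E a∈A) hasX ⊆⊤

  parent-exists : ∀ {U W} → U ∈ᴸ 𝓗 → W ∈ᴸ 𝓗 → U ⊂ W → ∃ (Parent 𝓗 U)
  parent-exists {U} U∈𝓗 W∈𝓗 U⊂W =
    least (U ⊂?_) (λ U⊂E → proj₁ U⊂E (proj₂ (nonempty U∈𝓗))) W∈𝓗 U⊂W

  parent-unique : ∀ {C D D'} → Parent 𝓗 C D → Parent 𝓗 C D' → D ≡ D'
  parent-unique (D∈𝓗 , C⊂D , D-least) (D'∈𝓗 , C⊂D' , D'-least) =
    ⊆-antisym (D-least D'∈𝓗 C⊂D') (D'-least D∈𝓗 C⊂D)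

  module _ {E : EdgeSet n} (E⊆E𝓗 : E ⊆E 𝓗) where

    adj-⊆ : ∀ {D V U W} → E (D , V) → Adj 𝓗 E U W → U ⊆ V → W ⊆ V
    adj-⊆ _ (inj₁ ((_ , _ , W⊂U , _) , _)) U⊆V = U⊆V ∘ proj₁ W⊂U
    adj-⊆ {D} {V} {U} {W} DV∈E (inj₂ ((_ , W-parent) , UW∉E)) U⊆V with U ⊂? V
    ... | yes U⊂V = proj₂ (proj₂ W-parent) (proj₁ (E⊆E𝓗 _ DV∈E)) U⊂V
    ... | no U⊄V = ⊥-elim (UW∉E (subst E (cong₂ _,_ D≡W V≡U) DV∈E))
      where
      V≡U : V ≡ U
      V≡U = ⊆-antisym (⊆∧⊄⇒⊇ U⊆V U⊄V) U⊆V
      D≡W : D ≡ W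
      D≡W = parent-unique (proj₂ (E⊆E𝓗 _ DV∈E)) (subst (λ C → Parent 𝓗 C W) (sym V≡U) W-parent)

    connected-⊆ : ∀ {D V U W} → E (D , V) → Connected 𝓗 E U W → U ⊆ V → W ⊆ V
    connected-⊆ DV∈E ε = id
    connected-⊆ DV∈E (U~W ◅ W~*) = connected-⊆ DV∈E W~* ∘ adj-⊆ DV∈E U~W

    connected⇒unseparated : ∀ {x y} → Connected 𝓗 E ⁅ x ⁆ ⁅ y ⁆ → Unseparated E x y
    connected⇒unseparated {x} {y} x~*y DV∈E = mk⇔
      (λ x∈V → connected-⊆ DV∈E x~*y (x∈p⇒⁅x⁆⊆p x∈V) (x∈⁅x⁆ y))
      (λ y∈V → connected-⊆ DV∈E (reverse ⊎-swap x~*y) (x∈p⇒⁅x⁆⊆p y∈V) (x∈⁅x⁆ x))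

    climb : ∀ {W x} → W ∈ᴸ 𝓗 → (∀ {D V} → E (D , V) → x ∈ V → W ⊆ V) →
            ∀ {U} → Acc _⊃_ U → U ∈ᴸ 𝓗 → x ∈ U → U ⊆ W → Connected 𝓗 E U W
    climb {W} W∈𝓗 W-below {U} (acc rec) U∈𝓗 x∈U U⊆W with U ⊂? W
    ... | no U⊄W = subst (Connected 𝓗 E U) (⊆-antisym U⊆W (⊆∧⊄⇒⊇ U⊆W U⊄W)) ε
    ... | yes U⊂W@(_ , _ , w∈W , w∉U) with parent-exists U∈𝓗 W∈𝓗 U⊂W
    ...   | P , P-parent@(P∈𝓗 , U⊂P , P-least) =
            inj₂ ((U∈𝓗 , P-parent) , λ PU∈E → w∉U (W-below PU∈E x∈U w∈W))
            ◅ climb W∈𝓗 W-below (rec U⊂P) P∈𝓗 (proj₁ U⊂P x∈U) (P-least W∈𝓗 U⊂W)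

    unseparated⇒connected : ∀ {x y} → Unseparated E x y → Connected 𝓗 E ⁅ x ⁆ ⁅ y ⁆
    unseparated⇒connected {x} {y} x~y
      with least (λ E → (x ∈? E) ×-dec (y ∈? E)) proj₁ hasX (∈⊤ , ∈⊤)
    ... | W , W∈𝓗 , (x∈W , y∈W) , W-least =
          climb W∈𝓗 (λ DV∈E x∈V → W-least (V∈𝓗 DV∈E) (x∈V , Equivalence.to (x~y DV∈E) x∈V))
                (⊃-wellFounded _) (singletons x) (x∈⁅x⁆ x) (x∈p⇒⁅x⁆⊆p x∈W)
          ◅◅ reverse ⊎-swap
             (climb W∈𝓗 (λ DV∈E y∈V → W-least (V∈𝓗 DV∈E) (Equivalence.from (x~y DV∈E) y∈V , y∈V))
                    (⊃-wellFounded _) (singletons y) (x∈⁅x⁆ y) (x∈p⇒⁅x⁆⊆p y∈W))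
      where
      V∈𝓗 : ∀ {D V} → E (D , V) → V ∈ᴸ 𝓗
      V∈𝓗 DV∈E = proj₁ (E⊆E𝓗 _ DV∈E)

    connected⇔unseparated : ∀ {x y} → Connected 𝓗 E ⁅ x ⁆ ⁅ y ⁆ ⇔ Unseparated E x y
    connected⇔unseparated = mk⇔ connected⇒unseparated unseparated⇒connected

module LcaEdgesOfPartition {n : ℕ} {𝓟 𝓗 : SetSystem n} (part : IsPartition 𝓟) (hier : IsHierarchy 𝓗) where
  open IsPartition part
  open IsHierarchy hier using (hasX)
  open Tree hier

  lcaEdges⊆E : LcaEdges 𝓟 𝓗 ⊆E 𝓗
  lcaEdges⊆E _ (_ , _ , (C∈𝓗 , _) , _ , C-parent) = C∈𝓗 , C-parent

  blocks-equal : ∀ {A B x y} → A ∈ᴸ 𝓟 → B ∈ᴸ 𝓟 → x ∈ A → y ∈ B → SameBlock 𝓟 x y → A ≡ B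
  blocks-equal {A} {B} A∈𝓟 B∈𝓟 x∈A y∈B (C , C∈𝓟 , x∈C , y∈C) =
    trans (sym (meet A∈𝓟 x∈A x∈C)) (meet B∈𝓟 y∈B y∈C)
    where
    meet : ∀ {A z} → A ∈ᴸ 𝓟 → z ∈ A → z ∈ C → C ≡ A
    meet A∈𝓟 z∈A z∈C with disjoint C∈𝓟 A∈𝓟
    ... | inj₁ C≡A = C≡A
    ... | inj₂ C∩A≡∅ = ⊥-elim (C∩A≡∅ (_ , x∈p∩q⁺ (z∈C , z∈A)))

  lcaEdges-unseparated⇒∈lca : ∀ {A C x y} → Unseparated (LcaEdges 𝓟 𝓗) x y →
                              A ∈ᴸ 𝓟 → Lca 𝓗 A C → x ∈ C → y ∈ C
  lcaEdges-unseparated⇒∈lca {A} {C} x~y A∈𝓟 C-lca@(C∈𝓗 , _) x∈C with C ⊂? ⊤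
  ... | no C⊄⊤ = ⊆∧⊄⇒⊇ ⊆⊤ C⊄⊤ ∈⊤
  ... | yes C⊂⊤@(_ , z , _ , z∉C) with parent-exists C∈𝓗 hasX C⊂⊤
  ...   | D , D-parent = Equivalence.to (x~y (A , A∈𝓟 , C-lca , C≢⊤ , D-parent)) x∈C
    where
    C≢⊤ : ¬ C ≡ ⊤
    C≢⊤ C≡⊤ = z∉C (subst (z ∈_) (sym C≡⊤) ∈⊤)

  module _ {H' : EdgeSet n} (H'⊆E𝓗 : H' ⊆E 𝓗)
           (sameBlock⇔unseparated : ∀ x y → SameBlock 𝓟 x y ⇔ Unseparated H' x y) where

    block-⊆ : ∀ {A x D V} → A ∈ᴸ 𝓟 → x ∈ A → H' (D , V) → x ∈ V → A ⊆ V
    block-⊆ A∈𝓟 x∈A DV∈H' x∈V a∈A =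
      Equivalence.to (Equivalence.to (sameBlock⇔unseparated _ _) (_ , A∈𝓟 , x∈A , a∈A) DV∈H') x∈V

    -- Were some y ∈ A outside V, no edge of H' would separate x from B, so A = B ⊆ V.
    block-⊆-lca : ∀ {A B V x} → A ∈ᴸ 𝓟 → x ∈ A → B ∈ᴸ 𝓟 → Lca 𝓗 B V → x ∈ V → A ⊆ V
    block-⊆-lca {A} {B} {V} {x} A∈𝓟 x∈A B∈𝓟 (V∈𝓗 , B⊆V , V-least) x∈V {y} y∈A with y ∈? V
    ... | yes y∈V = y∈V
    ... | no y∉V = B⊆V (subst (y ∈_) A≡B y∈A)
      where
      b : Fin n
      b = proj₁ (nonempty B∈𝓟)
      b∈B : b ∈ B
      b∈B = proj₂ (nonempty B∈𝓟)

      x~b : Unseparated H' x b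
      x~b {V = V'} DV'∈H' = mk⇔ to (λ b∈V' → V-least V'∈𝓗 (block-⊆ B∈𝓟 b∈B DV'∈H' b∈V') x∈V)
        where
        V'∈𝓗 : V' ∈ᴸ 𝓗
        V'∈𝓗 = proj₁ (H'⊆E𝓗 _ DV'∈H')
        to : x ∈ V' → b ∈ V'
        to x∈V' with nested V∈𝓗 V'∈𝓗 x∈V x∈V'
        ... | inj₁ V⊆V' = V⊆V' (B⊆V b∈B)
        ... | inj₂ V'⊆V = ⊥-elim (y∉V (V'⊆V (block-⊆ A∈𝓟 x∈A DV'∈H' x∈V' y∈A)))

      A≡B : A ≡ B
      A≡B = blocks-equal A∈𝓟 B∈𝓟 x∈A b∈B (Equivalence.from (sameBlock⇔unseparated x b) x~b)

    sameBlock⇒lcaEdges-unseparated : ∀ {x y} → SameBlock 𝓟 x y → Unseparated (LcaEdges 𝓟 𝓗) x y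
    sameBlock⇒lcaEdges-unseparated (A , A∈𝓟 , x∈A , y∈A) (B , B∈𝓟 , V-lca , _) = mk⇔
      (λ x∈V → block-⊆-lca A∈𝓟 x∈A B∈𝓟 V-lca x∈V y∈A)
      (λ y∈V → block-⊆-lca A∈𝓟 y∈A B∈𝓟 V-lca y∈V x∈A)

    lcaEdges-unseparated⇒∈H' : ∀ {x y D V} → Unseparated (LcaEdges 𝓟 𝓗) x y → H' (D , V) → x ∈ V → y ∈ V
    lcaEdges-unseparated⇒∈H' {x} x~y DV∈H' x∈V with covers x
    ... | A , A∈𝓟 , x∈A with lca-exists x∈A
    ...   | C , C-lca@(_ , A⊆C , C-least) =
            C-least (proj₁ (H'⊆E𝓗 _ DV∈H')) (block-⊆ A∈𝓟 x∈A DV∈H' x∈V)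
              (lcaEdges-unseparated⇒∈lca x~y A∈𝓟 C-lca (A⊆C x∈A))

    sameBlock⇔lcaEdges-unseparated : ∀ x y → SameBlock 𝓟 x y ⇔ Unseparated (LcaEdges 𝓟 𝓗) x y
    sameBlock⇔lcaEdges-unseparated x y = mk⇔ sameBlock⇒lcaEdges-unseparated λ x~y →
      Equivalence.from (sameBlock⇔unseparated x y) λ DV∈H' →
        mk⇔ (lcaEdges-unseparated⇒∈H' x~y DV∈H') (lcaEdges-unseparated⇒∈H' (⇔-sym ∘ x~y) DV∈H')

corollary4p7 : (n : ℕ) → n ≥ 2 → (𝓟 𝓗 : SetSystem n) → IsPartition 𝓟 → IsHierarchy 𝓗 →
    (Compatible 𝓟 𝓗 ⇔ PartitionEqF 𝓟 𝓗 (LcaEdges 𝓟 𝓗))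
corollary4p7 _ _ 𝓟 𝓗 part hier = mk⇔ lcaEdges-realise (λ 𝓟≡𝓕 → LcaEdges 𝓟 𝓗 , lcaEdges⊆E , 𝓟≡𝓕)
  where
  open Tree hier using (connected⇔unseparated)
  open LcaEdgesOfPartition part hier

  lcaEdges-realise : Compatible 𝓟 𝓗 → PartitionEqF 𝓟 𝓗 (LcaEdges 𝓟 𝓗)
  lcaEdges-realise (H' , H'⊆E𝓗 , 𝓟≡𝓕) x y =
    ⇔-trans (sameBlock⇔lcaEdges-unseparated H'⊆E𝓗 sameBlock⇔unseparated x y)
            (⇔-sym (connected⇔unseparated lcaEdges⊆E))
    where
    sameBlock⇔unseparated : ∀ x y → SameBlock 𝓟 x y ⇔ Unseparated H' x y
    sameBlock⇔unseparated x y = ⇔-trans (𝓟≡𝓕 x y) (connected⇔unseparated H'⊆E𝓗)
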